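{- Let $S$ be a set and $f\colon 2^S\to 2^S$ monotonic with respect to $\subseteq$. Then: (1) $(\nu f,\ \nu f\times\nu f)$ is a support ordering for $f$; (2) there is a well-ordering $\prec\subseteq \mu f\times\mu f$ such that $(\mu f,\prec)$ is a support ordering for $f$.
   Context: $\mu f,\nu f$ are the least and greatest fixpoints of $f$. A support ordering for $f$ is a pair $(X,\prec)$ with $X\subseteq S$ and $\prec\subseteq X\times X$ such that for every $x\in X$, $x\in f(\{x'\in X\mid x'\prec x\})$. A well-ordering is a relation that is irreflexive, transitive, total on distinct elements, and well-founded (every nonempty subset has a minimal element). The Axiom of Choice is assumed. -}

module Defs where

open import Level using (Level; _⊔_; Lift) renaming (suc to lsuc)
open import Data.Unit using (⊤)
open import Data.Product using (Σ; ∃; _×_; _,_)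
open import Data.Sum using (_⊎_)
open import Relation.Nullary using (¬_)
open import Relation.Unary using (Pred; _⊆_)
open import Relation.Binary using (Rel)
open import Relation.Binary.PropositionalEquality using (_≡_)
open import Axiom.ExcludedMiddle public using (ExcludedMiddle)

Monotone : ∀ {ℓ} {S : Set ℓ} → (Pred S ℓ → Pred S ℓ) → Set (lsuc ℓ)
Monotone {S = S} f = ∀ {P Q : Pred S _} → P ⊆ Q → f P ⊆ f Q

IsFixpoint : ∀ {ℓ} {S : Set ℓ} → (Pred S ℓ → Pred S ℓ) → Pred S ℓ → Set ℓ
IsFixpoint f P = (f P ⊆ P) × (P ⊆ f P)

IsLeastFixpoint : ∀ {ℓ} {S : Set ℓ} → (Pred S ℓ → Pred S ℓ) → Pred S ℓ → Set (lsuc ℓ)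
IsLeastFixpoint {S = S} f M =
  IsFixpoint f M × (∀ (P : Pred S _) → IsFixpoint f P → M ⊆ P)

IsGreatestFixpoint : ∀ {ℓ} {S : Set ℓ} → (Pred S ℓ → Pred S ℓ) → Pred S ℓ → Set (lsuc ℓ)
IsGreatestFixpoint {S = S} f N =
  IsFixpoint f N × (∀ (P : Pred S _) → IsFixpoint f P → P ⊆ N)

IsSupportOrdering : ∀ {ℓ} {S : Set ℓ} → (Pred S ℓ → Pred S ℓ) → Pred S ℓ → Rel S ℓ → Set ℓ
IsSupportOrdering f X _≺_ =
  (∀ x y → x ≺ y → X x × X y) ×
  (∀ x → X x → f (λ x' → X x' × x' ≺ x) x)

IsWellOrderingOn : ∀ {ℓ} {S : Set ℓ} → Pred S ℓ → Rel S ℓ → Set (lsuc ℓ)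
IsWellOrderingOn {S = S} X _≺_ =
  (∀ x → X x → ¬ (x ≺ x)) ×
  (∀ x y z → X x → X y → X z → x ≺ y → y ≺ z → x ≺ z) ×
  (∀ x y → X x → X y → ¬ (x ≡ y) → (x ≺ y) ⊎ (y ≺ x)) ×
  (∀ (P : Pred S _) → P ⊆ X → ∃ P →
     ∃ λ m → P m × (∀ y → P y → ¬ (y ≺ m)))

-- The Axiom of Choice, in its equivalent form of the well-ordering theorem:
-- every set (of level ℓ) admits a well-ordering.
WellOrderingTheorem : ∀ ℓ → Set (lsuc ℓ)
WellOrderingTheorem ℓ =
  ∀ (A : Set ℓ) → ∃ λ (R : Rel A ℓ) → IsWellOrderingOn (λ (_ : A) → Lift ℓ ⊤) R

{-# OPTIONS --safe #-}

-- Part (1) holds because νf ⊆ f νf and f is monotone.  For part (2), iterate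
-- f transfinitely along a well-ordering of S → Bool: stage i := f (⋃_{j<i} stage j).
-- If every stage added a new element, choosing one per stage would inject
-- S → Bool into S, contradicting Cantor; so some stage adds nothing, the union
-- of the stages is then a fixpoint, and μf is covered.  Ordering μf first by
-- the first stage containing an element and then by a well-ordering of S gives
-- a well-ordering in which every x ∈ μf is produced by f from its predecessors.
module Submission where

open import Defs
open import Level using (Level; Lift) renaming (suc to lsuc)
open import Axiom.DoubleNegationElimination using (em⇒dne)
open import Data.Bool using (Bool; true; not)
open import Data.Bool.Properties using (not-¬)
open import Data.Empty using (⊥; ⊥-elim)
open import Data.Product using (Σ; ∃; ∃₂; _×_; _,_; proj₁; proj₂)
open import Data.Product.Relation.Binary.Lex.Strict using (×-Lex; ×-transitive)
open import Data.Sum using (_⊎_; inj₁; inj₂; fromInj₂; map)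
open import Data.Unit using (⊤)
open import Function using (_on_)
open import Function.Definitions using (Injective)
open import Induction.WellFounded using (Acc; acc; WellFounded; module All)
open import Relation.Nullary using (¬_; yes; no)
open import Relation.Unary using (Pred; _⊆_)
open import Relation.Binary using (Rel; Transitive)
open import Relation.Binary.PropositionalEquality as ≡ using (_≡_; _≢_; refl; cong; subst)

private
  variable
    ℓ : Level

IsWellOrdering : {A : Set ℓ} → Rel A ℓ → Set (lsuc ℓ)
IsWellOrdering {ℓ} _<_ = IsWellOrderingOn (λ _ → Lift ℓ ⊤) _<_

module WellOrdering (em : ExcludedMiddle ℓ) {A : Set ℓ} {_<_ : Rel A ℓ}
                    (wo : IsWellOrdering _<_) where

  irrefl : ∀ x → ¬ x < x
  irrefl x = proj₁ wo x _

  trans : Transitive _<_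
  trans {x} {y} {z} = proj₁ (proj₂ wo) x y z _ _ _

  connex : ∀ x y → x ≢ y → x < y ⊎ y < x
  connex x y = proj₁ (proj₂ (proj₂ wo)) x y _ _

  least : (P : Pred A ℓ) → ∃ P → ∃ λ m → P m × (∀ y → P y → ¬ y < m)
  least P = proj₂ (proj₂ (proj₂ wo)) P _

  ≮⇒≡⊎> : ∀ {x y} → ¬ x < y → y ≡ x ⊎ y < x
  ≮⇒≡⊎> {x} {y} x≮y with em {y ≡ x}
  ... | yes y≡x = inj₁ y≡x
  ... | no y≢x with connex y x y≢x
  ...   | inj₁ y<x = inj₂ y<x
  ...   | inj₂ x<y = ⊥-elim (x≮y x<y)

  -- A least non-accessible element would be accessible.
  wellFounded : WellFounded _<_
  wellFounded x = em⇒dne em λ x∉Acc →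
    let m , m∉Acc , m-least = least (λ y → ¬ Acc _<_ y) (x , x∉Acc)
    in m∉Acc (acc λ {y} y<m → em⇒dne em λ y∉Acc → m-least y y∉Acc y<m)

×-Lex-isWellOrdering : ExcludedMiddle ℓ → {A B : Set ℓ} {_<₁_ : Rel A ℓ} {_<₂_ : Rel B ℓ} →
  IsWellOrdering _<₁_ → IsWellOrdering _<₂_ → IsWellOrdering (×-Lex _≡_ _<₁_ _<₂_)
×-Lex-isWellOrdering em {_<₁_ = _<₁_} {_<₂_} wo₁ wo₂ =
  (λ _ _ → irrefl) ,
  (λ x y z _ _ _ → ×-transitive ≡.isEquivalence (≡.resp₂ _<₁_) W₁.trans W₂.trans {x} {y} {z}) ,
  (λ _ _ _ _ → compare) ,
  least
  where
  module W₁ = WellOrdering em wo₁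
  module W₂ = WellOrdering em wo₂

  irrefl : ∀ {x} → ¬ ×-Lex _≡_ _<₁_ _<₂_ x x
  irrefl {x₁ , _} (inj₁ x₁<x₁) = W₁.irrefl x₁ x₁<x₁
  irrefl {_ , x₂} (inj₂ (_ , x₂<x₂)) = W₂.irrefl x₂ x₂<x₂

  compare : ∀ {x₁ x₂ y₁ y₂} → (x₁ , x₂) ≢ (y₁ , y₂) →
    ×-Lex _≡_ _<₁_ _<₂_ (x₁ , x₂) (y₁ , y₂) ⊎ ×-Lex _≡_ _<₁_ _<₂_ (y₁ , y₂) (x₁ , x₂)
  compare {x₁} {x₂} {y₁} {y₂} x≢y with em {x₁ ≡ y₁}
  ... | no x₁≢y₁ with W₁.connex x₁ y₁ x₁≢y₁
  ...   | inj₁ x₁<y₁ = inj₁ (inj₁ x₁<y₁)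
  ...   | inj₂ y₁<x₁ = inj₂ (inj₁ y₁<x₁)
  compare {x₂ = x₂} {y₂ = y₂} x≢y | yes refl with W₂.connex x₂ y₂ (λ { refl → x≢y refl })
  ...   | inj₁ x₂<y₂ = inj₁ (inj₂ (refl , x₂<y₂))
  ...   | inj₂ y₂<x₂ = inj₂ (inj₂ (refl , y₂<x₂))

  least : (P : Pred _ _) → P ⊆ (λ _ → Lift _ ⊤) → ∃ P →
    ∃ λ m → P m × (∀ y → P y → ¬ ×-Lex _≡_ _<₁_ _<₂_ y m)
  least P _ ((x₁ , x₂) , Px)
    with m₁ , ∃Pm₁ , m₁-least ← W₁.least (λ a → ∃ λ b → P (a , b)) (x₁ , x₂ , Px)
    with m₂ , Pm , m₂-least ← W₂.least (λ b → P (m₁ , b)) ∃Pm₁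
    = (m₁ , m₂) , Pm , λ { (y₁ , y₂) Py (inj₁ y₁<m₁) → m₁-least y₁ (y₂ , Py) y₁<m₁
                         ; (_ , y₂) Py (inj₂ (refl , y₂<m₂)) → m₂-least y₂ Py y₂<m₂ }

on-isWellOrdering : {A B : Set ℓ} {_<_ : Rel B ℓ} {g : A → B} →
  Injective _≡_ _≡_ g → IsWellOrdering _<_ → IsWellOrdering (_<_ on g)
on-isWellOrdering {_<_ = _<_} {g} g-injective (irrefl , trans , connex , least) =
  (λ x _ → irrefl (g x) _) ,
  (λ x y z _ _ _ → trans (g x) (g y) (g z) _ _ _) ,
  (λ x y _ _ x≢y → connex (g x) (g y) _ _ (λ gx≡gy → x≢y (g-injective gx≡gy))) ,
  λ P _ (x , Px) →
    let _ , (m , Pm , gm≡b) , b-least = least (λ b → ∃ λ a → P a × g a ≡ b) _ (g x , x , Px , refl)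
    in m , Pm , λ y Py gy<gm → b-least (g y) (y , Py , refl) (subst (_ <_) gm≡b gy<gm)

Restricted : {A : Set ℓ} → Pred A ℓ → Rel A ℓ → Rel A ℓ
Restricted X _<_ x y = X x × X y × x < y

restricted-isWellOrderingOn : {A : Set ℓ} {X : Pred A ℓ} {_<_ : Rel A ℓ} →
  IsWellOrdering _<_ → IsWellOrderingOn X (Restricted X _<_)
restricted-isWellOrderingOn (irrefl , trans , connex , least) =
  (λ x _ (_ , _ , x<x) → irrefl x _ x<x) ,
  (λ x y z _ _ _ (Xx , _ , x<y) (_ , Xz , y<z) → Xx , Xz , trans x y z _ _ _ x<y y<z) ,
  (λ x y Xx Xy x≢y → map (λ x<y → Xx , Xy , x<y) (λ y<x → Xy , Xx , y<x)
                          (connex x y _ _ x≢y)) ,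
  λ P _ nonempty →
    let m , Pm , m-least = least P _ nonempty
    in m , Pm , λ y Py (_ , _ , y<m) → m-least y Py y<m

cantor : ExcludedMiddle ℓ → {S : Set ℓ} (n : (S → Bool) → S) → ¬ Injective _≡_ _≡_ n
cantor em {S} n n-injective = not-¬ refl (proj₂ (diagonal (n d)) d refl)
  where
  diagonal : (s : S) → Σ Bool λ v → ∀ a → n a ≡ s → v ≡ not (a s)
  diagonal s with em {∃ λ a → n a ≡ s}
  ... | yes (a , na≡s) =
    not (a s) , λ b nb≡s → cong (λ c → not (c s)) (n-injective (≡.trans na≡s (≡.sym nb≡s)))
  ... | no ∄a = true , λ a na≡s → ⊥-elim (∄a (a , na≡s))

  d : S → Bool
  d s = proj₁ (diagonal s)

postfixpoint⇒supportOrdering : {S : Set ℓ} {f : Pred S ℓ → Pred S ℓ} {X : Pred S ℓ} →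
  Monotone f → X ⊆ f X → IsSupportOrdering f X (λ x y → X x × X y)
postfixpoint⇒supportOrdering mono X⊆fX =
  (λ _ _ Xx×Xy → Xx×Xy) , λ x Xx → mono (λ Xx′ → Xx′ , Xx′ , Xx) (X⊆fX Xx)

module Stages {S : Set ℓ} (f : Pred S ℓ → Pred S ℓ) (mono : Monotone f)
              {I : Set ℓ} {_<_ : Rel I ℓ} (wf : WellFounded _<_) where

  stageAcc : ∀ i → Acc _<_ i → Pred S ℓ
  stageAcc i (acc rs) = f (λ s → ∃₂ λ j (j<i : j < i) → stageAcc j (rs j<i) s)

  stageAcc-irrelevant : ∀ i (p q : Acc _<_ i) → stageAcc i p ⊆ stageAcc i q
  stageAcc-irrelevant i (acc rs) (acc qs) =
    mono λ (j , j<i , s∈j) → j , j<i , stageAcc-irrelevant j (rs j<i) (qs j<i) s∈j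

  stage : I → Pred S ℓ
  stage i = stageAcc i (wf i)

  below : I → Pred S ℓ
  below i s = ∃ λ j → j < i × stage j s

  ⋃stages : Pred S ℓ
  ⋃stages s = ∃ λ i → stage i s

  stage⊆f-below : ∀ i → stage i ⊆ f (below i)
  stage⊆f-below i with wf i
  ... | acc rs = mono λ (j , j<i , s∈j) → j , j<i , stageAcc-irrelevant j (rs j<i) (wf j) s∈j

  f-below⊆stage : ∀ i → f (below i) ⊆ stage i
  f-below⊆stage i with wf i
  ... | acc rs = mono λ (j , j<i , s∈j) → j , j<i , stageAcc-irrelevant j (wf j) (rs j<i) s∈j

  stage⊆prefixpoint : {P : Pred S ℓ} → f P ⊆ P → ∀ i → stage i ⊆ P
  stage⊆prefixpoint fP⊆P = All.wfRec wf ℓ (λ i → stage i ⊆ _) λ i ih s∈i →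
    fP⊆P (mono (λ (j , j<i , s∈j) → ih j<i s∈j) (stage⊆f-below i s∈i))

  stable⇒fixpoint : ∀ {i} → stage i ⊆ below i → IsFixpoint f ⋃stages
  stable⇒fixpoint {i} stable =
    (λ s∈f⋃ → i , f-below⊆stage i (mono (λ (j , s∈j) → stage⊆below-i j s∈j) s∈f⋃)) ,
    (λ (j , s∈j) → mono (λ (k , _ , s∈k) → k , s∈k) (stage⊆f-below j s∈j))
    where
    stage⊆below-i : ∀ j → stage j ⊆ below i
    stage⊆below-i = All.wfRec wf ℓ (λ j → stage j ⊆ below i) λ j ih s∈j →
      stable (f-below⊆stage i (mono (λ (k , k<j , s∈k) → ih k<j s∈k) (stage⊆f-below j s∈j)))

module Stabilisation (em : ExcludedMiddle ℓ) {S : Set ℓ}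
                     (f : Pred S ℓ → Pred S ℓ) (mono : Monotone f)
                     {_<_ : Rel (S → Bool) ℓ} (wo : IsWellOrdering _<_) where

  open WellOrdering em wo
  open Stages f mono wellFounded

  Fresh : (S → Bool) → Pred S ℓ
  Fresh i s = stage i s × ¬ below i s

  stable⊎fresh : ∀ i → stage i ⊆ below i ⊎ ∃ (Fresh i)
  stable⊎fresh i with em {∃ (Fresh i)}
  ... | yes fresh = inj₂ fresh
  ... | no ∄fresh = inj₁ λ {s} s∈i → em⇒dne em λ s∉below → ∄fresh (s , s∈i , s∉below)

  fresh-injective : {n : (S → Bool) → S} → (∀ i → Fresh i (n i)) → Injective _≡_ _≡_ n
  fresh-injective {n} fresh {i} {j} ni≡nj = em⇒dne em λ i≢j → lt⇒⊥ (connex i j i≢j)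
    where
    lt⇒⊥ : i < j ⊎ j < i → ⊥
    lt⇒⊥ (inj₁ i<j) = proj₂ (fresh j) (i , i<j , subst (stage i) ni≡nj (proj₁ (fresh i)))
    lt⇒⊥ (inj₂ j<i) = proj₂ (fresh i) (j , j<i , subst (stage j) (≡.sym ni≡nj) (proj₁ (fresh j)))

  stabilises : ∃ λ i → stage i ⊆ below i
  stabilises = em⇒dne em λ ∄stable →
    let fresh : ∀ i → ∃ (Fresh i)
        fresh i = fromInj₂ (λ stable → ⊥-elim (∄stable (i , stable))) (stable⊎fresh i)
    in cantor em (λ i → proj₁ (fresh i)) (fresh-injective (λ i → proj₂ (fresh i)))

  ⋃stages-isFixpoint : IsFixpoint f ⋃stages
  ⋃stages-isFixpoint = stable⇒fixpoint (proj₂ stabilises)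

module LeastFixpointOrdering (em : ExcludedMiddle ℓ) {S : Set ℓ}
                             {f : Pred S ℓ → Pred S ℓ} (mono : Monotone f)
                             {μf : Pred S ℓ} (lfp : IsLeastFixpoint f μf)
                             {_<_ : Rel (S → Bool) ℓ} (wo : IsWellOrdering _<_)
                             {_⊏_ : Rel S ℓ} (wo-S : IsWellOrdering _⊏_) where

  open WellOrdering em wo
  open Stages f mono wellFounded
  open Stabilisation em f mono wo using (⋃stages-isFixpoint)

  rank-spec : ∀ x → Σ (S → Bool) λ r → ⋃stages x → stage r x × (∀ i → stage i x → ¬ i < r)
  rank-spec x with em {⋃stages x}
  ... | yes x∈⋃ = let r , x∈r , r-least = least (λ i → stage i x) x∈⋃
                  in r , λ _ → x∈r , r-least
  ... | no x∉⋃ = (λ _ → true) , λ x∈⋃ → ⊥-elim (x∉⋃ x∈⋃)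

  rank : S → (S → Bool)
  rank x = proj₁ (rank-spec x)

  μf⊆⋃stages : μf ⊆ ⋃stages
  μf⊆⋃stages = proj₂ lfp ⋃stages ⋃stages-isFixpoint

  stage⊆μf : ∀ i → stage i ⊆ μf
  stage⊆μf = stage⊆prefixpoint (proj₁ (proj₁ lfp))

  rank-≤ : ∀ {i x} → stage i x → rank x ≡ i ⊎ rank x < i
  rank-≤ {i} {x} x∈i = ≮⇒≡⊎> (proj₂ (proj₂ (rank-spec x) (i , x∈i)) i x∈i)

  rankKey : S → (S → Bool) × S
  rankKey x = rank x , x

  _≺_ : Rel S ℓ
  _≺_ = Restricted μf (×-Lex _≡_ _<_ _⊏_ on rankKey)

  isWellOrderingOn : IsWellOrderingOn μf _≺_
  isWellOrderingOn = restricted-isWellOrderingOn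
    (on-isWellOrdering {g = rankKey} (cong proj₂) (×-Lex-isWellOrdering em wo wo-S))

  below-rank⊆predecessors : ∀ {y} → μf y → below (rank y) ⊆ λ x → μf x × x ≺ y
  below-rank⊆predecessors {y} y∈μf (i , i<ry , x∈i) =
    x∈μf , x∈μf , y∈μf , inj₁ (rank-<-rank (rank-≤ x∈i))
    where
    x∈μf = stage⊆μf i x∈i
    rank-<-rank : ∀ {x} → rank x ≡ i ⊎ rank x < i → rank x < rank y
    rank-<-rank (inj₁ refl) = i<ry
    rank-<-rank (inj₂ rx<i) = trans rx<i i<ry

  isSupportOrdering : IsSupportOrdering f μf _≺_
  isSupportOrdering =
    (λ _ _ (x∈μf , y∈μf , _) → x∈μf , y∈μf) ,
    λ y y∈μf → mono (below-rank⊆predecessors y∈μf)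
                    (stage⊆f-below (rank y) (proj₁ (proj₂ (rank-spec y) (μf⊆⋃stages y∈μf))))

corollary3 : ∀ {ℓ : Level} → ExcludedMiddle ℓ → WellOrderingTheorem ℓ →
    (S : Set ℓ) (f : Pred S ℓ → Pred S ℓ) → Monotone f →
    (μf νf : Pred S ℓ) → IsLeastFixpoint f μf → IsGreatestFixpoint f νf →
    IsSupportOrdering f νf (λ x y → νf x × νf y) ×
    (∃ λ (_≺_ : Rel S ℓ) → IsWellOrderingOn μf _≺_ × IsSupportOrdering f μf _≺_)
corollary3 em wot S f mono μf νf lfp gfp =
  postfixpoint⇒supportOrdering mono (proj₂ (proj₁ gfp)) ,
  μf-Ordering._≺_ , μf-Ordering.isWellOrderingOn , μf-Ordering.isSupportOrdering
  where
  module μf-Ordering = LeastFixpointOrdering em mono lfp (proj₂ (wot (S → Bool))) (proj₂ (wot S))
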